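{- Let $G$ and $H$ be graphs without isolated vertices satisfying $\gamma_{\mathrm{pr}}(G)=2\rho_3(G)$ and $\gamma_{\mathrm{pr}}(H)=2\rho_3(H)$. Then $$\gamma_{\mathrm{pr}}(G\times H)\ge \tfrac12\,\gamma_{\mathrm{pr}}(G)\,\gamma_{\mathrm{pr}}(H).$$
   Context: All graphs are finite and simple. The direct product $G\times H$ has vertex set $V(G)\times V(H)$, with $(u_G,u_H)$ adjacent to $(v_G,v_H)$ iff $u_Gv_G\in E(G)$ and $u_Hv_H\in E(H)$. A set $D$ is dominating if every vertex is in $D$ or adjacent to a vertex of $D$. For a graph without isolated vertices, $\gamma_{\mathrm{pr}}$ is the minimum size of a dominating set whose induced subgraph has a perfect matching. A $3$-packing of $G$ is a set $P\subseteq V(G)$ such that any two distinct vertices of $P$ are at distance greater than $3$ in $G$; $\rho_3(G)$ is the maximum size of a $3$-packing. -}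

module Defs where

open import Data.Nat using (ℕ; zero; suc; _*_; _≤_)
open import Data.Fin using (Fin; remQuot)
open import Data.Fin.Subset using (Subset; _∈_; ∣_∣)
open import Data.Product using (_×_; _,_; proj₁; proj₂; ∃; ∃-syntax; Σ-syntax)
open import Data.Empty using (⊥)
open import Data.Sum using (_⊎_)
open import Relation.Nullary using (¬_)
open import Relation.Binary.PropositionalEquality using (_≡_; _≢_)

record Graph : Set₁ where
  field
    order : ℕ
    Adj   : Fin order → Fin order → Set
    sym   : ∀ {u v} → Adj u v → Adj v u
    irrefl : ∀ {u} → ¬ Adj u u

open Graph public

NoIsolated : Graph → Set
NoIsolated G = ∀ (u : Fin (order G)) → ∃[ v ] Adj G u v

-- Direct (tensor) product; vertex set Fin (m * n) ≅ Fin m × Fin n via remQuot.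
fstV : (G H : Graph) → Fin (order G * order H) → Fin (order G)
fstV G H x = proj₁ (remQuot {order G} (order H) x)

sndV : (G H : Graph) → Fin (order G * order H) → Fin (order H)
sndV G H x = proj₂ (remQuot {order G} (order H) x)

_×ᵍ_ : Graph → Graph → Graph
G ×ᵍ H = record
  { order = order G * order H
  ; Adj = λ x y → Adj G (fstV G H x) (fstV G H y) × Adj H (sndV G H x) (sndV G H y)
  ; sym = λ { (a , b) → Graph.sym G a , Graph.sym H b }
  ; irrefl = λ { (a , b) → Graph.irrefl G a }
  }

module _ (G : Graph) where
  private V = Fin (order G)

  Dominating : Subset (order G) → Set
  Dominating D = ∀ (v : V) → (v ∈ D) ⊎ (∃[ u ] (u ∈ D × Adj G u v))

  -- The induced subgraph G[D] has a perfect matching: a partner map m on D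
  -- that is an involution along edges of G staying inside D.
  HasPerfectMatching : Subset (order G) → Set
  HasPerfectMatching D =
    Σ[ m ∈ (V → V) ] (∀ (v : V) → v ∈ D → (m v ∈ D) × Adj G v (m v) × (m (m v) ≡ v))

  PairedDominating : Subset (order G) → Set
  PairedDominating D = Dominating D × HasPerfectMatching D

  IsPairedDomNumber : ℕ → Set
  IsPairedDomNumber k =
    (∃[ D ] (PairedDominating D × ∣ D ∣ ≡ k))
    × (∀ D → PairedDominating D → k ≤ ∣ D ∣)

  data Walk : ℕ → V → V → Set where
    here : ∀ {v} → Walk zero v v
    step : ∀ {k u w v} → Adj G u w → Walk k w v → Walk (suc k) u v

  DistLe3 : V → V → Set
  DistLe3 u v = ∃[ k ] (k ≤ 3 × Walk k u v)

  Packing3 : Subset (order G) → Set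
  Packing3 P = ∀ u v → u ∈ P → v ∈ P → u ≢ v → ¬ DistLe3 u v

  IsPacking3Number : ℕ → Set
  IsPacking3Number k =
    (∃[ P ] (Packing3 P × ∣ P ∣ ≡ k))
    × (∀ P → Packing3 P → ∣ P ∣ ≤ k)

module Submission where

-- Let P, Q be 3-packings of G, H and D a paired dominating set of G × H with matching m.
-- Pick for every corner (p , q) ∈ P × Q a vertex x ∈ D dominating it.  If two of the
-- vertices x, m x, x′, m x′ coincide (x ≠ m x since G × H is loopless), then x and x′ are
-- equal or adjacent, so in each factor the two corners are joined by a walk of length ≤ 3
-- and hence coincide.  So |D| ≥ 2 |P| |Q|, i.e. γpr(G × H) ≥ 2 ρ₃(G) ρ₃(H) = γpr(G) γpr(H) / 2.

open import Defs
open import Data.Nat using (ℕ; _*_; _≤_)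
open import Relation.Binary.PropositionalEquality using (_≡_)

open import Data.Nat using (_+_; z≤n; s≤s)
open import Data.Nat.Properties using (+-mono-≤; ≤-trans; ≤-reflexive; *-monoʳ-≤)
open import Data.Nat.Solver using (module +-*-Solver)
open import Data.Bool using (true; false)
open import Data.Fin using (Fin; zero; suc; combine; _≟_)
open import Data.Fin.Properties using (injective⇒≤; remQuot-combine; suc-injective; *↔×)
open import Data.Fin.Subset using (Subset; _∈_; ∣_∣)
open import Data.Fin.Subset.Properties using (drop-there)
open import Data.Vec using (_∷_; here; there)
open import Data.Product using (_×_; _,_; proj₁; proj₂; ∃-syntax; Σ-syntax)
open import Data.Product.Function.NonDependent.Propositional using (_×-↔_)
open import Data.Sum using (_⊎_; inj₁; inj₂)
open import Data.Empty using (⊥-elim)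
open import Relation.Nullary using (yes; no)
open import Relation.Binary.PropositionalEquality
  using (_≢_; refl; trans; cong; subst)
  renaming (sym to ≡-sym)
open import Function.Bundles using (_↣_; mk↣; Injection)
open import Function.Construct.Composition using (_↣-∘_)
open import Function.Definitions using (Injective)
open import Function.Properties.Inverse using (↔-refl; ↔-trans; ↔⇒↣)

enum : ∀ {n} (p : Subset n) → Fin ∣ p ∣ → Fin n
enum (true  ∷ p) zero    = zero
enum (true  ∷ p) (suc i) = suc (enum p i)
enum (false ∷ p) i       = suc (enum p i)

enum∈ : ∀ {n} (p : Subset n) (i : Fin ∣ p ∣) → enum p i ∈ p
enum∈ (true  ∷ p) zero    = here
enum∈ (true  ∷ p) (suc i) = there (enum∈ p i)
enum∈ (false ∷ p) i       = there (enum∈ p i)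

enum-injective : ∀ {n} (p : Subset n) → Injective _≡_ _≡_ (enum p)
enum-injective (true  ∷ p) {zero}  {zero}  e = refl
enum-injective (true  ∷ p) {suc i} {suc j} e = cong suc (enum-injective p (suc-injective e))
enum-injective (false ∷ p)                 e = enum-injective p (suc-injective e)

rank : ∀ {n} (p : Subset n) (x : Fin n) → x ∈ p → Fin ∣ p ∣
rank (true  ∷ p) zero    x∈p = zero
rank (true  ∷ p) (suc x) x∈p = suc (rank p x (drop-there x∈p))
rank (false ∷ p) (suc x) x∈p = rank p x (drop-there x∈p)

enum-rank : ∀ {n} (p : Subset n) (x : Fin n) (x∈p : x ∈ p) → enum p (rank p x x∈p) ≡ x
enum-rank (true  ∷ p) zero    x∈p = refl
enum-rank (true  ∷ p) (suc x) x∈p = cong suc (enum-rank p x (drop-there x∈p))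
enum-rank (false ∷ p) (suc x) x∈p = cong suc (enum-rank p x (drop-there x∈p))

rank-injective : ∀ {n} (p : Subset n) {x y : Fin n} (x∈p : x ∈ p) (y∈p : y ∈ p) →
                 rank p x x∈p ≡ rank p y y∈p → x ≡ y
rank-injective p {x} {y} x∈p y∈p e =
  trans (≡-sym (enum-rank p x x∈p)) (trans (cong (enum p) e) (enum-rank p y y∈p))

↣-into-subset⇒≤∣∣ : ∀ {n k} (p : Subset n) (f : Fin k ↣ Fin n) →
                    (∀ i → Injection.to f i ∈ p) → k ≤ ∣ p ∣
↣-into-subset⇒≤∣∣ p f f∈p = injective⇒≤ {f = λ i → rank p (to i) (f∈p i)}
  (λ {i} {j} e → injective (rank-injective p (f∈p i) (f∈p j) e))
  where open Injection f

module _ (G : Graph) where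

  DistLe1 : Fin (order G) → Fin (order G) → Set
  DistLe1 u v = u ≡ v ⊎ Adj G u v

  distLe1-sym : ∀ {u v} → DistLe1 u v → DistLe1 v u
  distLe1-sym (inj₁ e) = inj₁ (≡-sym e)
  distLe1-sym (inj₂ a) = inj₂ (Graph.sym G a)

  walk-++ : ∀ {k l u w v} → Walk G k u w → Walk G l w v → Walk G (k + l) u v
  walk-++ here       q = q
  walk-++ (step a p) q = step a (walk-++ p q)

  distLe1⇒walk : ∀ {u v} → DistLe1 u v → ∃[ k ] (k ≤ 1 × Walk G k u v)
  distLe1⇒walk (inj₁ refl) = 0 , z≤n , here
  distLe1⇒walk (inj₂ a)    = 1 , s≤s z≤n , step a here

  distLe1³⇒distLe3 : ∀ {a b c d} → DistLe1 a b → DistLe1 b c → DistLe1 c d → DistLe3 G a d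
  distLe1³⇒distLe3 ab bc cd
    with k₁ , k₁≤1 , w₁ ← distLe1⇒walk ab
       | k₂ , k₂≤1 , w₂ ← distLe1⇒walk bc
       | k₃ , k₃≤1 , w₃ ← distLe1⇒walk cd
    = k₁ + (k₂ + k₃) , +-mono-≤ k₁≤1 (+-mono-≤ k₂≤1 k₃≤1) , walk-++ w₁ (walk-++ w₂ w₃)

  packing3-distLe1³⇒≡ : ∀ {P a b c d} → Packing3 G P → a ∈ P → d ∈ P →
                        DistLe1 a b → DistLe1 b c → DistLe1 c d → a ≡ d
  packing3-distLe1³⇒≡ {a = a} {d = d} pack a∈P d∈P ab bc cd with a ≟ d
  ... | yes a≡d = a≡d
  ... | no  a≢d = ⊥-elim (pack a d a∈P d∈P a≢d (distLe1³⇒distLe3 ab bc cd))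

module _ (G H : Graph) where

  private
    V = Fin (order G * order H)
    π₁ = fstV G H
    π₂ = sndV G H

  Close : V → V → Set
  Close x y = DistLe1 G (π₁ x) (π₁ y) × DistLe1 H (π₂ x) (π₂ y)

  close-refl : ∀ {x} → Close x x
  close-refl = inj₁ refl , inj₁ refl

  adj⇒close : ∀ {x y} → Adj (G ×ᵍ H) x y → Close x y
  adj⇒close (a , b) = inj₂ a , inj₂ b

  dominating⇒close : ∀ {D} → Dominating (G ×ᵍ H) D → ∀ v → Σ[ w ∈ V ] (w ∈ D × Close w v)
  dominating⇒close dom v with dom v
  ... | inj₁ v∈D           = v , v∈D , close-refl
  ... | inj₂ (u , u∈D , a) = u , u∈D , adj⇒close a

  module _ {P : Subset (order G)} {Q : Subset (order H)}
           (packP : Packing3 G P) (packQ : Packing3 H Q)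
           {D : Subset (order G * order H)} (dom : Dominating (G ×ᵍ H) D)
           (m : V → V)
           (match : ∀ v → v ∈ D → (m v ∈ D) × Adj (G ×ᵍ H) v (m v) × (m (m v) ≡ v)) where

    corner : Fin ∣ P ∣ → Fin ∣ Q ∣ → V
    corner a c = combine (enum P a) (enum Q c)

    dominator : Fin ∣ P ∣ → Fin ∣ Q ∣ → V
    dominator a c = proj₁ (dominating⇒close dom (corner a c))

    dominator∈D : ∀ a c → dominator a c ∈ D
    dominator∈D a c = proj₁ (proj₂ (dominating⇒close dom (corner a c)))

    dominator-close : ∀ a c → DistLe1 G (π₁ (dominator a c)) (enum P a)
                                × DistLe1 H (π₂ (dominator a c)) (enum Q c)
    dominator-close a c
      with remQuot-combine {order G} {order H} (enum P a) (enum Q c)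
         | proj₂ (proj₂ (dominating⇒close dom (corner a c)))
    ... | e | closeG , closeH =
      subst (DistLe1 G _) (cong proj₁ e) closeG , subst (DistLe1 H _) (cong proj₂ e) closeH

    -- corner – dominator – dominator′ – corner′ is a chain of three short steps in each factor.
    close-dominators⇒same-corner : ∀ {a c a′ c′} → Close (dominator a c) (dominator a′ c′) →
                                   a ≡ a′ × c ≡ c′
    close-dominators⇒same-corner {a} {c} {a′} {c′} (closeG , closeH)
      with dominator-close a c | dominator-close a′ c′
    ... | aG , cH | a′G , c′H =
      enum-injective P (packing3-distLe1³⇒≡ G packP (enum∈ P a) (enum∈ P a′)
                          (distLe1-sym G aG) closeG a′G) ,
      enum-injective Q (packing3-distLe1³⇒≡ H packQ (enum∈ Q c) (enum∈ Q c′)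
                          (distLe1-sym H cH) closeH c′H)

    partner : Fin ∣ P ∣ → Fin ∣ Q ∣ → V
    partner a c = m (dominator a c)

    partner-adj : ∀ a c → Adj (G ×ᵍ H) (dominator a c) (partner a c)
    partner-adj a c = proj₁ (proj₂ (match _ (dominator∈D a c)))

    partner-involutive : ∀ a c → m (partner a c) ≡ dominator a c
    partner-involutive a c = proj₂ (proj₂ (match _ (dominator∈D a c)))

    dominator≢own-partner : ∀ {a c} → dominator a c ≢ partner a c
    dominator≢own-partner {a} {c} e = Graph.irrefl (G ×ᵍ H)
      (subst (Adj (G ×ᵍ H) (dominator a c)) (≡-sym e) (partner-adj a c))

    dominator≡partner⇒same-corner : ∀ {a c a′ c′} → dominator a c ≡ partner a′ c′ →
                                    a ≡ a′ × c ≡ c′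
    dominator≡partner⇒same-corner {a′ = a′} {c′} e = close-dominators⇒same-corner
      (subst (λ x → Close x (dominator a′ c′)) (≡-sym e)
        (adj⇒close (Graph.sym (G ×ᵍ H) (partner-adj a′ c′))))

    dominator≢partner : ∀ {a c a′ c′} → dominator a c ≢ partner a′ c′
    dominator≢partner e with dominator≡partner⇒same-corner e
    ... | refl , refl = dominator≢own-partner e

    chosen : Fin 2 × Fin ∣ P ∣ × Fin ∣ Q ∣ → V
    chosen (zero     , a , c) = dominator a c
    chosen (suc zero , a , c) = partner a c

    chosen∈D : ∀ t → chosen t ∈ D
    chosen∈D (zero     , a , c) = dominator∈D a c
    chosen∈D (suc zero , a , c) = proj₁ (match _ (dominator∈D a c))

    dominator-injective : ∀ {a c a′ c′} → dominator a c ≡ dominator a′ c′ → (a , c) ≡ (a′ , c′)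
    dominator-injective e with close-dominators⇒same-corner (subst (Close _) e close-refl)
    ... | refl , refl = refl

    chosen-injective : Injective _≡_ _≡_ chosen
    chosen-injective {zero     , _} {zero     , _} e = cong (zero ,_) (dominator-injective e)
    chosen-injective {zero     , _} {suc zero , _} e = ⊥-elim (dominator≢partner e)
    chosen-injective {suc zero , _} {zero     , _} e = ⊥-elim (dominator≢partner (≡-sym e))
    chosen-injective {suc zero , a , c} {suc zero , a′ , c′} e =
      cong (suc zero ,_) (dominator-injective
        (trans (≡-sym (partner-involutive a c)) (trans (cong m e) (partner-involutive a′ c′))))

    2*∣P∣*∣Q∣≤∣D∣ : 2 * (∣ P ∣ * ∣ Q ∣) ≤ ∣ D ∣
    2*∣P∣*∣Q∣≤∣D∣ = ↣-into-subset⇒≤∣∣ D (mk↣ chosen-injective ↣-∘ index)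
                      (λ i → chosen∈D (Injection.to index i))
      where
      index : Fin (2 * (∣ P ∣ * ∣ Q ∣)) ↣ (Fin 2 × Fin ∣ P ∣ × Fin ∣ Q ∣)
      index = ↔⇒↣ (↔-trans *↔× (↔-refl ×-↔ *↔×))

proposition11 : (G H : Graph) → NoIsolated G → NoIsolated H →
    (gG rG gH rH gGH : ℕ) →
    IsPairedDomNumber G gG → IsPacking3Number G rG → gG ≡ 2 * rG →
    IsPairedDomNumber H gH → IsPacking3Number H rH → gH ≡ 2 * rH →
    IsPairedDomNumber (G ×ᵍ H) gGH →
    gG * gH ≤ 2 * gGH
proposition11 G H _ _ gG rG gH rH gGH _ ((P , packP , refl) , _) refl
                                      _ ((Q , packQ , refl) , _) refl
                                      ((D , (dom , m , match) , refl) , _) =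
  ≤-trans (≤-reflexive (double-product ∣ P ∣ ∣ Q ∣))
          (*-monoʳ-≤ 2 (2*∣P∣*∣Q∣≤∣D∣ G H packP packQ dom m match))
  where
  open +-*-Solver
  double-product : ∀ a b → (2 * a) * (2 * b) ≡ 2 * (2 * (a * b))
  double-product = solve 2 (λ a b → (con 2 :* a) :* (con 2 :* b) := con 2 :* (con 2 :* (a :* b))) refl
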